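{- Let $W$ be a Coxeter group with simple reflections $S$, $\mathbf{w}=(s_1,\dots,s_m)$ a word in $S$ with $w=s_1\cdots s_m$, and $\mathbf{u}$ a subword of $\mathbf{w}$ with $u=u_1\cdots u_m$. Then the product, taken from left to right, of the reflections $s_j^{U_{(j)}}$ over the indices $j$ with $u_j=e$ (in increasing order of $j$) equals $wu^{ -1}$.
   Context: A subword is $\mathbf{u}=(u_1,\dots,u_m)$ with $u_i\in\{s_i,e\}$; $U_{(j)}=u_1\cdots u_j$; $s^x=xsx^{ -1}$. -}

module Defs where

open import Level using (Level; _⊔_) renaming (suc to lsuc)
open import Algebra.Bundles using (Group)
open import Algebra.Morphism.Structures using (module GroupMorphisms)
open import Data.Nat using (ℕ; zero; suc; _≤?_)
open import Data.Fin using (Fin; toℕ)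
open import Data.Bool using (Bool; true; false)
open import Data.Bool.Properties using () renaming (_≟_ to _≟ᵇ_)
open import Data.Maybe using (Maybe; just)
open import Data.List using (List; map; filter; foldr; allFin)
open import Data.Product using (Σ; _×_; _,_)
open import Relation.Binary.PropositionalEquality using (_≡_; _≢_)

pow : {c ℓ : Level} (G : Group c ℓ) → Group.Carrier G → ℕ → Group.Carrier G
pow G x zero = Group.ε G
pow G x (suc k) = Group._∙_ G x (pow G x k)

module _ {c ℓ : Level} (G : Group c ℓ) where
  open Group G

  prodL : List Carrier → Carrier
  prodL = foldr _∙_ ε

  -- s^x = x s x⁻¹
  conj : Carrier → Carrier → Carrier
  conj x s = x ∙ s ∙ x ⁻¹

  -- A Coxeter system (W, S) on the group G: generators indexed by a type S,
  -- a Coxeter matrix m (nothing = ∞), and G is presented by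
  -- ⟨ S | (s t)^{m(s,t)} = e ⟩ (universal property: existence and uniqueness
  -- of homomorphisms to any group of the same levels).
  record CoxeterSystem : Set (lsuc (c ⊔ ℓ)) where
    field
      S      : Set c
      gen    : S → Carrier
      mat    : S → S → Maybe ℕ
      mat-diag : ∀ s → mat s s ≡ just 1
      mat-sym  : ∀ s t → mat s t ≡ mat t s
      mat-off  : ∀ s t → s ≢ t → (mat s t ≢ just 0) × (mat s t ≢ just 1)
      rel      : ∀ s t k → mat s t ≡ just k → pow G (gen s ∙ gen t) k ≈ ε
      univ-ex  : (H : Group c ℓ) (f : S → Group.Carrier H) →
                 (∀ s t k → mat s t ≡ just k →
                    Group._≈_ H (pow H (Group._∙_ H (f s) (f t)) k) (Group.ε H)) →
                 Σ (Carrier → Group.Carrier H) λ φ →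
                   GroupMorphisms.IsGroupHomomorphism (Group.rawGroup G) (Group.rawGroup H) φ
                   × (∀ s → Group._≈_ H (φ (gen s)) (f s))
      univ-uniq : (H : Group c ℓ) (φ ψ : Carrier → Group.Carrier H) →
                 GroupMorphisms.IsGroupHomomorphism (Group.rawGroup G) (Group.rawGroup H) φ →
                 GroupMorphisms.IsGroupHomomorphism (Group.rawGroup G) (Group.rawGroup H) ψ →
                 (∀ s → Group._≈_ H (φ (gen s)) (ψ (gen s))) →
                 ∀ x → Group._≈_ H (φ x) (ψ x)

  module _ (C : CoxeterSystem) {m : ℕ} (w : Fin m → CoxeterSystem.S C)
           (keep : Fin m → Bool) where
    open CoxeterSystem C
    -- the word w = (s_1,...,s_m) is  w : Fin m → S ; a subword u is given by
    -- keep : Fin m → Bool with u_j = s_j if keep j = true and u_j = e otherwise.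

    uLetter : Fin m → Carrier
    uLetter j with keep j
    ... | true  = gen (w j)
    ... | false = ε

    wordVal : Carrier
    wordVal = prodL (map (λ j → gen (w j)) (allFin m))

    subVal : Carrier
    subVal = prodL (map uLetter (allFin m))

    prefixU : Fin m → Carrier
    prefixU j = prodL (map uLetter (filter (λ k → toℕ k ≤? toℕ j) (allFin m)))

    reflProd : Carrier
    reflProd = prodL (map (λ j → conj (prefixU j) (gen (w j)))
                          (filter (λ j → keep j ≟ᵇ false) (allFin m)))

{-# OPTIONS --safe #-}
-- Peel off the first letter s of the word. Every prefix U_(j+1) begins with
-- u_1, so the reflections coming from the tail are those of the shorter word
-- conjugated by u_1. If s is kept, the inductive value w′u′⁻¹ is thus
-- conjugated by s, giving (s w′)(s u′)⁻¹; if s is dropped, position 1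
-- contributes s^{U_(1)} = s on the left, giving (s w′) u′⁻¹.
module Submission where

open import Defs
open import Level using (Level)
open import Algebra.Bundles using (Group)
open import Data.Nat using (ℕ; zero; suc; _≤_; _≤?_; s≤s; s≤s⁻¹)
open import Data.Fin using (Fin; toℕ; zero; suc)
open import Data.Bool using (Bool; true; false)
open import Data.Bool.Properties using (not-¬) renaming (_≟_ to _≟ᵇ_)
open import Data.List using (List; []; _∷_; map; filter; allFin)
open import Data.List.Properties
  using (map-∘; map-cong; map-tabulate; filter-accept; filter-reject; filter-≐; filter-none)
open import Data.List.Relation.Unary.All using (universal)
open import Function using (_∘_; id)
open import Relation.Nullary using (does)
open import Relation.Unary using (Pred; Decidable)
open import Relation.Binary.PropositionalEquality as ≡ using (_≡_; cong; cong₂; module ≡-Reasoning)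
open import Data.Product using (_,_)
import Algebra.Properties.Group as GroupProperties
import Relation.Binary.Reasoning.Setoid as SetoidReasoning

filter-map : ∀ {a b p} {A : Set a} {B : Set b} {P : Pred B p} (P? : Decidable P)
             (f : A → B) (xs : List A) →
             filter P? (map f xs) ≡ map f (filter (P? ∘ f) xs)
filter-map P? f [] = ≡.refl
filter-map P? f (x ∷ xs) with does (P? (f x))
... | true  = cong (f x ∷_) (filter-map P? f xs)
... | false = filter-map P? f xs

allFin-suc : ∀ m → allFin (suc m) ≡ zero ∷ map suc (allFin m)
allFin-suc m = cong (zero ∷_) (≡.sym (map-tabulate id suc))

module _ {c ℓ : Level} (G : Group c ℓ) (C : CoxeterSystem G) where
  open Group G using (Carrier; _∙_; ε)
  open CoxeterSystem C using (S; gen)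
  open ≡-Reasoning

  uLetter-kept : ∀ {m} (w : Fin m → S) keep j → keep j ≡ true → uLetter G C w keep j ≡ gen (w j)
  uLetter-kept w keep j eq rewrite eq = ≡.refl

  uLetter-dropped : ∀ {m} (w : Fin m → S) keep j → keep j ≡ false → uLetter G C w keep j ≡ ε
  uLetter-dropped w keep j eq rewrite eq = ≡.refl

  module _ {m : ℕ} (w : Fin (suc m) → S) (keep : Fin (suc m) → Bool) where

    uLetter-suc : ∀ j → uLetter G C w keep (suc j) ≡ uLetter G C (w ∘ suc) (keep ∘ suc) j
    uLetter-suc j with keep (suc j)
    ... | true  = ≡.refl
    ... | false = ≡.refl

    prodL-uLetter-suc : ∀ xs → prodL G (map (uLetter G C w keep) (map suc xs))
                               ≡ prodL G (map (uLetter G C (w ∘ suc) (keep ∘ suc)) xs)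
    prodL-uLetter-suc xs = cong (prodL G) (≡.trans (≡.sym (map-∘ xs)) (map-cong uLetter-suc xs))

    wordVal-suc : wordVal G C w keep ≡ gen (w zero) ∙ wordVal G C (w ∘ suc) (keep ∘ suc)
    wordVal-suc = begin
      prodL G (map (gen ∘ w) (allFin (suc m)))
        ≡⟨ cong (prodL G ∘ map (gen ∘ w)) (allFin-suc m) ⟩
      gen (w zero) ∙ prodL G (map (gen ∘ w) (map suc (allFin m)))
        ≡⟨ cong (λ xs → gen (w zero) ∙ prodL G xs) (map-∘ (allFin m)) ⟨
      gen (w zero) ∙ wordVal G C (w ∘ suc) (keep ∘ suc) ∎

    subVal-suc : subVal G C w keep ≡ uLetter G C w keep zero ∙ subVal G C (w ∘ suc) (keep ∘ suc)
    subVal-suc = begin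
      prodL G (map (uLetter G C w keep) (allFin (suc m)))
        ≡⟨ cong (prodL G ∘ map (uLetter G C w keep)) (allFin-suc m) ⟩
      uLetter G C w keep zero ∙ prodL G (map (uLetter G C w keep) (map suc (allFin m)))
        ≡⟨ cong (uLetter G C w keep zero ∙_) (prodL-uLetter-suc (allFin m)) ⟩
      uLetter G C w keep zero ∙ subVal G C (w ∘ suc) (keep ∘ suc) ∎

    prefixU-zero : prefixU G C w keep zero ≡ uLetter G C w keep zero ∙ ε
    prefixU-zero = begin
      prodL G (map (uLetter G C w keep) (filter P? (allFin (suc m))))
        ≡⟨ cong (prodL G ∘ map (uLetter G C w keep) ∘ filter P?) (allFin-suc m) ⟩
      uLetter G C w keep zero ∙ prodL G (map (uLetter G C w keep) (filter P? (map suc (allFin m))))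
        ≡⟨ cong (λ xs → uLetter G C w keep zero ∙ prodL G (map (uLetter G C w keep) xs))
                (filter-map P? suc (allFin m)) ⟩
      uLetter G C w keep zero ∙ prodL G (map (uLetter G C w keep) (map suc (filter (P? ∘ suc) (allFin m))))
        ≡⟨ cong (λ xs → uLetter G C w keep zero ∙ prodL G (map (uLetter G C w keep) (map suc xs)))
                (filter-none (P? ∘ suc) (universal (λ _ ()) (allFin m))) ⟩
      uLetter G C w keep zero ∙ ε ∎
      where
      P? : Decidable (λ (k : Fin (suc m)) → toℕ k ≤ 0)
      P? k = toℕ k ≤? 0

    prefixU-suc : ∀ j → prefixU G C w keep (suc j)
                        ≡ uLetter G C w keep zero ∙ prefixU G C (w ∘ suc) (keep ∘ suc) j
    prefixU-suc j = begin
      prodL G (map (uLetter G C w keep) (filter P? (allFin (suc m))))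
        ≡⟨ cong (prodL G ∘ map (uLetter G C w keep) ∘ filter P?) (allFin-suc m) ⟩
      uLetter G C w keep zero ∙ prodL G (map (uLetter G C w keep) (filter P? (map suc (allFin m))))
        ≡⟨ cong (λ xs → uLetter G C w keep zero ∙ prodL G (map (uLetter G C w keep) xs))
                (filter-map P? suc (allFin m)) ⟩
      uLetter G C w keep zero ∙ prodL G (map (uLetter G C w keep) (map suc (filter (P? ∘ suc) (allFin m))))
        ≡⟨ cong (λ xs → uLetter G C w keep zero ∙ prodL G (map (uLetter G C w keep) (map suc xs)))
                (filter-≐ (P? ∘ suc) Q? (s≤s⁻¹ , s≤s) (allFin m)) ⟩
      uLetter G C w keep zero ∙ prodL G (map (uLetter G C w keep) (map suc (filter Q? (allFin m))))
        ≡⟨ cong (uLetter G C w keep zero ∙_) (prodL-uLetter-suc (filter Q? (allFin m))) ⟩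
      uLetter G C w keep zero ∙ prefixU G C (w ∘ suc) (keep ∘ suc) j ∎
      where
      P? : Decidable (λ (k : Fin (suc m)) → toℕ k ≤ toℕ (suc j))
      P? k = toℕ k ≤? toℕ (suc j)
      Q? : Decidable (λ (k : Fin m) → toℕ k ≤ toℕ j)
      Q? k = toℕ k ≤? toℕ j

module _ {c ℓ : Level} (G : Group c ℓ) where
  open Group G
  open GroupProperties G using (ε⁻¹≈ε; ⁻¹-anti-homo-∙; \\-leftDividesʳ)
  open SetoidReasoning setoid

  prodL-cong : ∀ {a} {A : Set a} {f g : A → Carrier} → (∀ x → f x ≈ g x) →
               ∀ xs → prodL G (map f xs) ≈ prodL G (map g xs)
  prodL-cong f≈g []       = refl
  prodL-cong f≈g (x ∷ xs) = ∙-cong (f≈g x) (prodL-cong f≈g xs)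

  conj-congˡ : ∀ {a b} x → a ≈ b → conj G a x ≈ conj G b x
  conj-congˡ x a≈b = ∙-cong (∙-congʳ a≈b) (⁻¹-cong a≈b)

  conj-congʳ : ∀ a {x y} → x ≈ y → conj G a x ≈ conj G a y
  conj-congʳ a x≈y = ∙-congʳ (∙-congˡ x≈y)

  conj-ε : ∀ x → conj G ε x ≈ x
  conj-ε x = trans (∙-cong (identityˡ x) ε⁻¹≈ε) (identityʳ x)

  conj-homo-ε : ∀ a → conj G a ε ≈ ε
  conj-homo-ε a = trans (∙-congʳ (identityʳ a)) (inverseʳ a)

  conj-homo-∙ : ∀ a x y → conj G a (x ∙ y) ≈ conj G a x ∙ conj G a y
  conj-homo-∙ a x y = begin
    a ∙ (x ∙ y) ∙ a ⁻¹               ≈⟨ ∙-congʳ (assoc a x y) ⟨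
    a ∙ x ∙ y ∙ a ⁻¹                 ≈⟨ assoc (a ∙ x) y (a ⁻¹) ⟩
    a ∙ x ∙ (y ∙ a ⁻¹)               ≈⟨ ∙-congˡ (∙-congʳ (\\-leftDividesʳ a y)) ⟨
    a ∙ x ∙ (a ⁻¹ ∙ (a ∙ y) ∙ a ⁻¹)  ≈⟨ ∙-congˡ (assoc (a ⁻¹) (a ∙ y) (a ⁻¹)) ⟩
    a ∙ x ∙ (a ⁻¹ ∙ (a ∙ y ∙ a ⁻¹))  ≈⟨ assoc (a ∙ x) (a ⁻¹) (a ∙ y ∙ a ⁻¹) ⟨
    a ∙ x ∙ a ⁻¹ ∙ (a ∙ y ∙ a ⁻¹)    ∎

  conj-∙ : ∀ a b x → conj G (a ∙ b) x ≈ conj G a (conj G b x)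
  conj-∙ a b x = begin
    a ∙ b ∙ x ∙ (a ∙ b) ⁻¹       ≈⟨ ∙-congˡ (⁻¹-anti-homo-∙ a b) ⟩
    a ∙ b ∙ x ∙ (b ⁻¹ ∙ a ⁻¹)    ≈⟨ assoc (a ∙ b ∙ x) (b ⁻¹) (a ⁻¹) ⟨
    a ∙ b ∙ x ∙ b ⁻¹ ∙ a ⁻¹      ≈⟨ ∙-congʳ (∙-congʳ (assoc a b x)) ⟩
    a ∙ (b ∙ x) ∙ b ⁻¹ ∙ a ⁻¹    ≈⟨ ∙-congʳ (assoc a (b ∙ x) (b ⁻¹)) ⟩
    a ∙ (b ∙ x ∙ b ⁻¹) ∙ a ⁻¹    ∎

  conj-∙-⁻¹ : ∀ a x y → conj G a (x ∙ y ⁻¹) ≈ (a ∙ x) ∙ (a ∙ y) ⁻¹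
  conj-∙-⁻¹ a x y = begin
    a ∙ (x ∙ y ⁻¹) ∙ a ⁻¹        ≈⟨ ∙-congʳ (assoc a x (y ⁻¹)) ⟨
    a ∙ x ∙ y ⁻¹ ∙ a ⁻¹          ≈⟨ assoc (a ∙ x) (y ⁻¹) (a ⁻¹) ⟩
    a ∙ x ∙ (y ⁻¹ ∙ a ⁻¹)        ≈⟨ ∙-congˡ (⁻¹-anti-homo-∙ a y) ⟨
    a ∙ x ∙ (a ∙ y) ⁻¹           ∎

  prodL-map-conj : ∀ {a} {A : Set a} g (f : A → Carrier) xs →
                   prodL G (map (conj G g ∘ f) xs) ≈ conj G g (prodL G (map f xs))
  prodL-map-conj g f []       = sym (conj-homo-ε g)
  prodL-map-conj g f (x ∷ xs) = begin
    conj G g (f x) ∙ prodL G (map (conj G g ∘ f) xs)  ≈⟨ ∙-congˡ (prodL-map-conj g f xs) ⟩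
    conj G g (f x) ∙ conj G g (prodL G (map f xs))    ≈⟨ conj-homo-∙ g (f x) _ ⟨
    conj G g (f x ∙ prodL G (map f xs))               ∎

  module _ (C : CoxeterSystem G) where
    open CoxeterSystem C using (S; gen)

    module _ {m : ℕ} (w : Fin (suc m) → S) (keep : Fin (suc m) → Bool) where

      dropped? : Decidable (λ (j : Fin (suc m)) → keep j ≡ false)
      dropped? j = keep j ≟ᵇ false

      reflection : Fin (suc m) → Carrier
      reflection j = conj G (prefixU G C w keep j) (gen (w j))

      reflProd-tail : prodL G (map reflection (filter dropped? (map suc (allFin m))))
                      ≈ conj G (uLetter G C w keep zero) (reflProd G C (w ∘ suc) (keep ∘ suc))
      reflProd-tail = begin
        prodL G (map reflection (filter dropped? (map suc (allFin m))))
          ≡⟨ cong (prodL G ∘ map reflection) (filter-map dropped? suc (allFin m)) ⟩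
        prodL G (map reflection (map suc tailDropped))
          ≡⟨ cong (prodL G) (map-∘ tailDropped) ⟨
        prodL G (map (reflection ∘ suc) tailDropped)
          ≈⟨ prodL-cong reflection-suc tailDropped ⟩
        prodL G (map (conj G (uLetter G C w keep zero) ∘ reflection′) tailDropped)
          ≈⟨ prodL-map-conj (uLetter G C w keep zero) reflection′ tailDropped ⟩
        conj G (uLetter G C w keep zero) (reflProd G C (w ∘ suc) (keep ∘ suc)) ∎
        where
        tailDropped : List (Fin m)
        tailDropped = filter (dropped? ∘ suc) (allFin m)
        reflection′ : Fin m → Carrier
        reflection′ j = conj G (prefixU G C (w ∘ suc) (keep ∘ suc) j) (gen (w (suc j)))
        reflection-suc : ∀ j → reflection (suc j) ≈ conj G (uLetter G C w keep zero) (reflection′ j)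
        reflection-suc j = begin
          reflection (suc j)
            ≡⟨ cong (λ p → conj G p (gen (w (suc j)))) (prefixU-suc G C w keep j) ⟩
          conj G (uLetter G C w keep zero ∙ prefixU G C (w ∘ suc) (keep ∘ suc) j) (gen (w (suc j)))
            ≈⟨ conj-∙ _ _ _ ⟩
          conj G (uLetter G C w keep zero) (reflection′ j) ∎

      reflProd-kept : keep zero ≡ true →
                      reflProd G C w keep ≈ conj G (gen (w zero)) (reflProd G C (w ∘ suc) (keep ∘ suc))
      reflProd-kept kept = begin
        prodL G (map reflection (filter dropped? (allFin (suc m))))
          ≡⟨ cong (prodL G ∘ map reflection ∘ filter dropped?) (allFin-suc m) ⟩
        prodL G (map reflection (filter dropped? (zero ∷ map suc (allFin m))))
          ≡⟨ cong (prodL G ∘ map reflection) (filter-reject dropped? (not-¬ kept)) ⟩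
        prodL G (map reflection (filter dropped? (map suc (allFin m))))
          ≈⟨ reflProd-tail ⟩
        conj G (uLetter G C w keep zero) (reflProd G C (w ∘ suc) (keep ∘ suc))
          ≡⟨ cong (λ u → conj G u (reflProd G C (w ∘ suc) (keep ∘ suc))) (uLetter-kept G C w keep zero kept) ⟩
        conj G (gen (w zero)) (reflProd G C (w ∘ suc) (keep ∘ suc)) ∎

      reflProd-dropped : keep zero ≡ false →
                         reflProd G C w keep ≈ gen (w zero) ∙ reflProd G C (w ∘ suc) (keep ∘ suc)
      reflProd-dropped drop = begin
        prodL G (map reflection (filter dropped? (allFin (suc m))))
          ≡⟨ cong (prodL G ∘ map reflection ∘ filter dropped?) (allFin-suc m) ⟩
        prodL G (map reflection (filter dropped? (zero ∷ map suc (allFin m))))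
          ≡⟨ cong (prodL G ∘ map reflection) (filter-accept dropped? drop) ⟩
        reflection zero ∙ prodL G (map reflection (filter dropped? (map suc (allFin m))))
          ≈⟨ ∙-cong reflection-zero (trans reflProd-tail (conj-congˡ _ (reflexive u₀≡ε))) ⟩
        gen (w zero) ∙ conj G ε (reflProd G C (w ∘ suc) (keep ∘ suc))
          ≈⟨ ∙-congˡ (conj-ε _) ⟩
        gen (w zero) ∙ reflProd G C (w ∘ suc) (keep ∘ suc) ∎
        where
        u₀≡ε : uLetter G C w keep zero ≡ ε
        u₀≡ε = uLetter-dropped G C w keep zero drop
        reflection-zero : reflection zero ≈ gen (w zero)
        reflection-zero = begin
          reflection zero
            ≡⟨ cong (λ p → conj G p (gen (w zero))) (prefixU-zero G C w keep) ⟩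
          conj G (uLetter G C w keep zero ∙ ε) (gen (w zero))
            ≈⟨ conj-congˡ _ (trans (identityʳ _) (reflexive u₀≡ε)) ⟩
          conj G ε (gen (w zero))
            ≈⟨ conj-ε _ ⟩
          gen (w zero) ∎

      wordVal∙subVal⁻¹-kept : keep zero ≡ true →
        conj G (gen (w zero)) (wordVal G C (w ∘ suc) (keep ∘ suc) ∙ subVal G C (w ∘ suc) (keep ∘ suc) ⁻¹)
        ≈ wordVal G C w keep ∙ subVal G C w keep ⁻¹
      wordVal∙subVal⁻¹-kept kept = begin
        conj G s (W′ ∙ U′ ⁻¹)                       ≈⟨ conj-∙-⁻¹ s W′ U′ ⟩
        s ∙ W′ ∙ (s ∙ U′) ⁻¹
          ≡⟨ cong (λ u → s ∙ W′ ∙ (u ∙ U′) ⁻¹) (uLetter-kept G C w keep zero kept) ⟨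
        s ∙ W′ ∙ (uLetter G C w keep zero ∙ U′) ⁻¹
          ≡⟨ cong₂ (λ x y → x ∙ y ⁻¹) (wordVal-suc G C w keep) (subVal-suc G C w keep) ⟨
        wordVal G C w keep ∙ subVal G C w keep ⁻¹   ∎
        where
        s W′ U′ : Carrier
        s = gen (w zero)
        W′ = wordVal G C (w ∘ suc) (keep ∘ suc)
        U′ = subVal G C (w ∘ suc) (keep ∘ suc)

      wordVal∙subVal⁻¹-dropped : keep zero ≡ false →
        gen (w zero) ∙ (wordVal G C (w ∘ suc) (keep ∘ suc) ∙ subVal G C (w ∘ suc) (keep ∘ suc) ⁻¹)
        ≈ wordVal G C w keep ∙ subVal G C w keep ⁻¹
      wordVal∙subVal⁻¹-dropped drop = begin
        s ∙ (W′ ∙ U′ ⁻¹)                            ≈⟨ assoc s W′ (U′ ⁻¹) ⟨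
        s ∙ W′ ∙ U′ ⁻¹                              ≈⟨ ∙-congˡ (⁻¹-cong (identityˡ U′)) ⟨
        s ∙ W′ ∙ (ε ∙ U′) ⁻¹
          ≡⟨ cong (λ u → s ∙ W′ ∙ (u ∙ U′) ⁻¹) (uLetter-dropped G C w keep zero drop) ⟨
        s ∙ W′ ∙ (uLetter G C w keep zero ∙ U′) ⁻¹
          ≡⟨ cong₂ (λ x y → x ∙ y ⁻¹) (wordVal-suc G C w keep) (subVal-suc G C w keep) ⟨
        wordVal G C w keep ∙ subVal G C w keep ⁻¹   ∎
        where
        s W′ U′ : Carrier
        s = gen (w zero)
        W′ = wordVal G C (w ∘ suc) (keep ∘ suc)
        U′ = subVal G C (w ∘ suc) (keep ∘ suc)

    reflProd≈wordVal∙subVal⁻¹ : ∀ {m} (w : Fin m → S) keep →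
                                reflProd G C w keep ≈ wordVal G C w keep ∙ subVal G C w keep ⁻¹
    reflProd≈wordVal∙subVal⁻¹ {zero}  w keep = sym (inverseʳ ε)
    -- an inspect-style helper rather than 'with keep zero', which would also
    -- abstract keep zero inside the unfolded prefix products
    reflProd≈wordVal∙subVal⁻¹ {suc m} w keep = byFirstLetter (keep zero) ≡.refl
      where
      ih : reflProd G C (w ∘ suc) (keep ∘ suc)
           ≈ wordVal G C (w ∘ suc) (keep ∘ suc) ∙ subVal G C (w ∘ suc) (keep ∘ suc) ⁻¹
      ih = reflProd≈wordVal∙subVal⁻¹ (w ∘ suc) (keep ∘ suc)
      byFirstLetter : ∀ b → keep zero ≡ b → reflProd G C w keep ≈ wordVal G C w keep ∙ subVal G C w keep ⁻¹
      byFirstLetter true kept =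
        trans (reflProd-kept w keep kept) (trans (conj-congʳ _ ih) (wordVal∙subVal⁻¹-kept w keep kept))
      byFirstLetter false drop =
        trans (reflProd-dropped w keep drop) (trans (∙-congˡ ih) (wordVal∙subVal⁻¹-dropped w keep drop))

proposition4p7 : {c ℓ : Level} (G : Group c ℓ) (C : CoxeterSystem G) {m : ℕ}
                 (w : Fin m → CoxeterSystem.S C) (keep : Fin m → Bool) →
                 Group._≈_ G (reflProd G C w keep)
                   (Group._∙_ G (wordVal G C w keep) (Group._⁻¹ G (subVal G C w keep)))
proposition4p7 G C w keep = reflProd≈wordVal∙subVal⁻¹ G C w keep
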